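{- Let $U$ be a set of $n$ jobs, $V$ a set of $m$ machines, and $b(j,i)\ge 0$ integer tolerances. Consider the following algorithm: start with $M=\emptyset$; consider the machines in an arbitrary order, and for each machine $i$, let $k$ be the maximal value such that there are $k$ jobs not yet matched with $b(j,i)\ge k$, and add $(j,i)$ to $M$ for the $k$ currently unmatched jobs $j$ with highest $b(j,i)$. Then the output $M$ is a PD-matching with $|M|\ge \tfrac12|M^*|$ for every PD-matching $M^*$, i.e., the algorithm is a $\tfrac12$-approximation for maximum PD-matching.
   Context: A PD-matching is a set $M\subseteq U\times V$ such that every job belongs to at most one pair of $M$, and for every $(j,i)\in M$, $d_i(M)\le b(j,i)$, where $d_i(M)=|\{j:(j,i)\in M\}|$. The maximum PD-matching problem asks for a PD-matching of maximum cardinality. -}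

module Defs where

open import Data.Nat using (ℕ; zero; suc; _+_; _≤_)
open import Data.Bool using (Bool; true; false; if_then_else_; _∨_; _∧_; not)
open import Data.Fin using (Fin; zero; suc; _≟_)
open import Data.List using (List; []; _∷_)
open import Relation.Nullary.Decidable using (⌊_⌋)
open import Relation.Binary.PropositionalEquality using (_≡_)

-- Jobs are Fin n, machines are Fin m, tolerances b : Fin n → Fin m → ℕ.
-- A set M ⊆ U × V is represented by its characteristic function.
Rel : ℕ → ℕ → Set
Rel n m = Fin n → Fin m → Bool

count : ∀ {k} → (Fin k → Bool) → ℕ
count {zero}  f = 0
count {suc k} f = (if f zero then 1 else 0) + count (λ x → f (suc x))

anyF : ∀ {k} → (Fin k → Bool) → Bool
anyF {zero}  f = false
anyF {suc k} f = f zero ∨ anyF (λ x → f (suc x))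

sumF : ∀ {k} → (Fin k → ℕ) → ℕ
sumF {zero}  f = 0
sumF {suc k} f = f zero + sumF (λ x → f (suc x))

card : ∀ {n m} → Rel n m → ℕ
card M = sumF (λ j → count (λ i → M j i))

deg : ∀ {n m} → Rel n m → Fin m → ℕ
deg M i = count (λ j → M j i)

record IsPDMatching {n m} (b : Fin n → Fin m → ℕ) (M : Rel n m) : Set where
  field
    atMostOne : ∀ j → count (λ i → M j i) ≤ 1
    tolerance : ∀ j i → M j i ≡ true → deg M i ≤ b j i

unmatched : ∀ {n m} → Rel n m → Fin n → Bool
unmatched M j = not (anyF (M j))

_≤ᵇ_ : ℕ → ℕ → Bool
zero  ≤ᵇ _     = true
suc _ ≤ᵇ zero  = false
suc x ≤ᵇ suc y = x ≤ᵇ y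

numAbove : ∀ {n m} → (Fin n → Fin m → ℕ) → Rel n m → Fin m → ℕ → ℕ
numAbove b M i k = count (λ j → unmatched M j ∧ (k ≤ᵇ b j i))

record Step {n m} (b : Fin n → Fin m → ℕ) (i : Fin m) (M M' : Rel n m) : Set where
  field
    k        : ℕ
    k-ok     : k ≤ numAbove b M i k
    k-max    : ∀ k' → k' ≤ numAbove b M i k' → k' ≤ k
    S        : Fin n → Bool
    S-unm    : ∀ j → S j ≡ true → unmatched M j ≡ true
    S-size   : count S ≡ k
    S-top    : ∀ j j' → S j ≡ true → unmatched M j' ≡ true → S j' ≡ false → b j' i ≤ b j i
    M'-def   : ∀ j i' → M' j i' ≡ (M j i' ∨ (S j ∧ ⌊ i' ≟ i ⌋))

data Run {n m} (b : Fin n → Fin m → ℕ) : List (Fin m) → Rel n m → Rel n m → Set where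
  done : ∀ {M} → Run b [] M M
  step : ∀ {i is M M' M''} → Step b i M M' → Run b is M' M'' → Run b (i ∷ is) M M''

emptyRel : ∀ {n m} → Rel n m
emptyRel _ _ = false

{-# OPTIONS --safe #-}
module Submission where

open import Defs
open import Data.Bool using (Bool; true; false; if_then_else_; _∧_; _∨_; not)
open import Data.Bool.Properties using (∨-identityʳ; ∨-zeroʳ; ∧-identityʳ; ∧-zeroʳ; not-injective)
open import Data.Fin using (Fin; zero; suc; _≟_)
open import Data.List using (List; allFin; _∷_)
open import Data.List.Membership.Propositional using (_∈_)
open import Data.List.Membership.Propositional.Properties using (∈-allFin)
open import Data.List.Relation.Binary.Permutation.Propositional using (_↭_; ↭-sym; ↭⇒↭ₛ)
open import Data.List.Relation.Binary.Permutation.Propositional.Properties using (∈-resp-↭)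
open import Data.List.Relation.Binary.Permutation.Setoid.Properties using (Unique-resp-↭)
open import Data.List.Relation.Unary.All using (lookup)
open import Data.List.Relation.Unary.AllPairs using (_∷_)
open import Data.List.Relation.Unary.Any using (here; there)
open import Data.List.Relation.Unary.Unique.Propositional using (Unique)
open import Data.List.Relation.Unary.Unique.Propositional.Properties using (allFin⁺)
open import Data.Nat using (ℕ; zero; suc; _+_; _*_; _≤_; _<_; z≤n; s≤s; _≤?_)
open import Data.Nat.Properties
  using (≤-reflexive; ≤-trans; <⇒≱; m≤n⇒m≤1+n; +-suc; +-identityʳ; +-mono-≤; +-monoˡ-≤; +-monoʳ-≤;
         +-commutativeSemigroup; module ≤-Reasoning)
open import Algebra.Properties.CommutativeSemigroup +-commutativeSemigroup using (interchange)
open import Data.Product using (_×_; _,_)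
open import Relation.Binary.PropositionalEquality
  using (_≡_; _≢_; _≗_; refl; sym; trans; cong; cong₂; subst; setoid; module ≡-Reasoning)
open import Relation.Nullary using (yes; no; contradiction)
open import Relation.Nullary.Decidable using (⌊_⌋; isYes≗does; dec-true; dec-false)

-- Fix any PD-matching M*. When the greedy algorithm processes machine i, the
-- jobs that M* assigns to i are of two kinds. Those already matched by the
-- greedy matching M are charged to their own pair in M; since M* uses each
-- job at most once, every pair of M is charged at most once in total. The a
-- jobs still unmatched all have b(j,i) ≥ d_i(M*) ≥ a, so the maximality of the
-- greedy choice k gives a ≤ k ≤ d_i(M). Summing over the machines,
-- |M*| ≤ |M| + |M|.

∧-elimˡ : ∀ {x y} → x ∧ y ≡ true → x ≡ true
∧-elimˡ {true} _ = refl

∧-elimʳ : ∀ {x y} → x ∧ y ≡ true → y ≡ true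
∧-elimʳ {true} y≡true = y≡true

∧-intro : ∀ {x y} → x ≡ true → y ≡ true → x ∧ y ≡ true
∧-intro refl refl = refl

≤ᵇ-sound : ∀ k x → k ≤ᵇ x ≡ true → k ≤ x
≤ᵇ-sound zero    x       _    = z≤n
≤ᵇ-sound (suc k) (suc x) k≤ᵇx = s≤s (≤ᵇ-sound k x k≤ᵇx)

≤ᵇ-complete : ∀ {k x} → k ≤ x → k ≤ᵇ x ≡ true
≤ᵇ-complete z≤n       = refl
≤ᵇ-complete (s≤s k≤x) = ≤ᵇ-complete k≤x

≟-diag : ∀ {k} (i : Fin k) → ⌊ i ≟ i ⌋ ≡ true
≟-diag i = trans (isYes≗does (i ≟ i)) (dec-true (i ≟ i) refl)

≟-off-diag : ∀ {k} {i i′ : Fin k} → i′ ≢ i → ⌊ i′ ≟ i ⌋ ≡ false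
≟-off-diag {i = i} {i′} i′≢i = trans (isYes≗does (i′ ≟ i)) (dec-false (i′ ≟ i) i′≢i)

_⊆ᵇ_ : ∀ {k} → (Fin k → Bool) → (Fin k → Bool) → Set
f ⊆ᵇ g = ∀ x → f x ≡ true → g x ≡ true

count-cong : ∀ {k} {f g : Fin k → Bool} → f ≗ g → count f ≡ count g
count-cong {zero}  f≗g = refl
count-cong {suc k} {f} {g} f≗g rewrite f≗g zero = cong (_ +_) (count-cong (λ x → f≗g (suc x)))

count-none : ∀ {k} {f : Fin k → Bool} → (∀ x → f x ≡ false) → count f ≡ 0
count-none {zero}  _     = refl
count-none {suc k} {f} none rewrite none zero = count-none (λ x → none (suc x))

count-mono : ∀ {k} {f g : Fin k → Bool} → f ⊆ᵇ g → count f ≤ count g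
count-mono {zero}  _   = z≤n
count-mono {suc k} {f} {g} f⊆g with f zero in f0 | g zero in g0
... | true  | true  = s≤s (count-mono (λ x → f⊆g (suc x)))
... | true  | false = contradiction (trans (sym (f⊆g zero f0)) g0) λ ()
... | false | true  = m≤n⇒m≤1+n (count-mono (λ x → f⊆g (suc x)))
... | false | false = count-mono (λ x → f⊆g (suc x))

count-strictMono : ∀ {k} {f g : Fin k → Bool} → f ⊆ᵇ g →
                   ∀ x → g x ≡ true → f x ≡ false → count f < count g
count-strictMono {suc k} {f} {g} f⊆g zero gx fx rewrite gx | fx =
  s≤s (count-mono (λ x → f⊆g (suc x)))
count-strictMono {suc k} {f} {g} f⊆g (suc y) gy fy with f zero in f0 | g zero in g0
... | true  | true  = s≤s (count-strictMono (λ x → f⊆g (suc x)) y gy fy)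
... | true  | false = contradiction (trans (sym (f⊆g zero f0)) g0) λ ()
... | false | true  = m≤n⇒m≤1+n (count-strictMono (λ x → f⊆g (suc x)) y gy fy)
... | false | false = count-strictMono (λ x → f⊆g (suc x)) y gy fy

count-partition : ∀ {k} (f g : Fin k → Bool) →
                  count f ≡ count (λ x → f x ∧ g x) + count (λ x → f x ∧ not (g x))
count-partition {zero}  f g = refl
count-partition {suc k} f g with f zero | g zero
... | true  | true  = cong suc (count-partition (λ x → f (suc x)) (λ x → g (suc x)))
... | true  | false = trans (cong suc (count-partition (λ x → f (suc x)) (λ x → g (suc x))))
                            (sym (+-suc _ _))
... | false | _     = count-partition (λ x → f (suc x)) (λ x → g (suc x))

count-≟ : ∀ {k} (i : Fin k) → count (λ x → ⌊ x ≟ i ⌋) ≡ 1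
count-≟ {suc k} zero    = cong suc (count-none {k} (λ _ → refl))
count-≟ {suc k} (suc i) = trans (count-cong suc-≟) (count-≟ i)
  where
  suc-≟ : ∀ x → ⌊ suc x ≟ suc i ⌋ ≡ ⌊ x ≟ i ⌋
  suc-≟ x with x ≟ i
  ... | yes refl = refl
  ... | no  _    = refl

anyF-intro : ∀ {k} (f : Fin k → Bool) x → f x ≡ true → anyF f ≡ true
anyF-intro f zero    fx rewrite fx = refl
anyF-intro f (suc x) fx with f zero
... | true  = refl
... | false = anyF-intro (λ x → f (suc x)) x fx

anyF-false : ∀ {k} (f : Fin k → Bool) → anyF f ≡ false → ∀ x → f x ≡ false
anyF-false f none zero    with f zero
... | false = refl
anyF-false f none (suc x) with f zero
... | false = anyF-false (λ x → f (suc x)) none x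

anyF-mono : ∀ {k} {f g : Fin k → Bool} → f ⊆ᵇ g → anyF f ≡ true → anyF g ≡ true
anyF-mono {suc k} {f} {g} f⊆g some with f zero in f0
... | true  = anyF-intro g zero (f⊆g zero f0)
... | false with g zero
...   | true  = refl
...   | false = anyF-mono (λ x → f⊆g (suc x)) some

anyF⇒1≤count : ∀ {k} (f : Fin k → Bool) → anyF f ≡ true → 1 ≤ count f
anyF⇒1≤count {suc k} f some with f zero
... | true  = s≤s z≤n
... | false = anyF⇒1≤count (λ x → f (suc x)) some

sumF-cong : ∀ {k} {f g : Fin k → ℕ} → f ≗ g → sumF f ≡ sumF g
sumF-cong {zero}  _   = refl
sumF-cong {suc k} f≗g = cong₂ _+_ (f≗g zero) (sumF-cong (λ x → f≗g (suc x)))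

sumF-mono : ∀ {k} {f g : Fin k → ℕ} → (∀ x → f x ≤ g x) → sumF f ≤ sumF g
sumF-mono {zero}  _   = z≤n
sumF-mono {suc k} f≤g = +-mono-≤ (f≤g zero) (sumF-mono (λ x → f≤g (suc x)))

sumF-zero : ∀ k → sumF {k} (λ _ → 0) ≡ 0
sumF-zero zero    = refl
sumF-zero (suc k) = sumF-zero k

sumF-+ : ∀ {k} (f g : Fin k → ℕ) → sumF (λ x → f x + g x) ≡ sumF f + sumF g
sumF-+ {zero}  f g = refl
sumF-+ {suc k} f g = trans (cong (f zero + g zero +_) (sumF-+ (λ x → f (suc x)) (λ x → g (suc x))))
                           (interchange (f zero) (g zero) _ _)

sumF-comm : ∀ {n m} (g : Fin n → Fin m → ℕ) →
            sumF (λ j → sumF (g j)) ≡ sumF (λ i → sumF (λ j → g j i))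
sumF-comm {zero}  {m} g = sym (sumF-zero m)
sumF-comm {suc n}     g = trans (cong (sumF (g zero) +_) (sumF-comm (λ j → g (suc j))))
                                (sym (sumF-+ (g zero) (λ i → sumF (λ j → g (suc j) i))))

count≡sumF : ∀ {k} (f : Fin k → Bool) → count f ≡ sumF (λ x → if f x then 1 else 0)
count≡sumF {zero}  f = refl
count≡sumF {suc k} f = cong ((if f zero then 1 else 0) +_) (count≡sumF (λ x → f (suc x)))

card≡sumF-deg : ∀ {n m} (M : Rel n m) → card M ≡ sumF (deg M)
card≡sumF-deg M = begin
  sumF (λ j → count (M j))                    ≡⟨ sumF-cong (λ j → count≡sumF (M j)) ⟩
  sumF (λ j → sumF (λ i → indicator j i))   ≡⟨ sumF-comm indicator ⟩
  sumF (λ i → sumF (λ j → indicator j i))   ≡⟨ sumF-cong (λ i → sym (count≡sumF (λ j → M j i))) ⟩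
  sumF (deg M)                                ∎
  where
  open ≡-Reasoning
  indicator : Fin _ → Fin _ → ℕ
  indicator j i = if M j i then 1 else 0

matched : ∀ {n m} → Rel n m → Fin n → Bool
matched M j = anyF (M j)

unmatched⇒free : ∀ {n m} (M : Rel n m) j → unmatched M j ≡ true → ∀ i → M j i ≡ false
unmatched⇒free M j u = anyF-false (M j) (not-injective {y = false} u)

_⊆ᴿ_ : ∀ {n m} → Rel n m → Rel n m → Set
M ⊆ᴿ M′ = ∀ j → M j ⊆ᵇ M′ j

matched-mono : ∀ {n m} {M M′ : Rel n m} → M ⊆ᴿ M′ →
               ∀ j → matched M j ≡ true → matched M′ j ≡ true
matched-mono M⊆M′ j = anyF-mono (M⊆M′ j)

emptyRel-isPDMatching : ∀ {n m} (b : Fin n → Fin m → ℕ) → IsPDMatching b emptyRel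
emptyRel-isPDMatching {m = m} b = record
  { atMostOne = λ j → ≤-trans (≤-reflexive (count-none {m} (λ _ → refl))) z≤n
  ; tolerance = λ _ _ ()
  }

Chargeable : ∀ {n m} → Rel n m → Rel n m → Fin m → Set
Chargeable M M* i = deg M* i ≤ count (λ j → M* j i ∧ matched M j) + deg M i

count-∧-matched-mono : ∀ {n m} {M M′ : Rel n m} (M* : Rel n m) i → M ⊆ᴿ M′ →
                       count (λ j → M* j i ∧ matched M j) ≤ count (λ j → M* j i ∧ matched M′ j)
count-∧-matched-mono M* i M⊆M′ =
  count-mono (λ j p → ∧-intro (∧-elimˡ p) (matched-mono M⊆M′ j (∧-elimʳ p)))

Chargeable-mono : ∀ {n m} {M M′ : Rel n m} (M* : Rel n m) i → M ⊆ᴿ M′ →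
                  Chargeable M M* i → Chargeable M′ M* i
Chargeable-mono M* i M⊆M′ charge =
  ≤-trans charge (+-mono-≤ (count-∧-matched-mono M* i M⊆M′) (count-mono (λ j → M⊆M′ j i)))

count-∧-matched≤ : ∀ {n m} (M M* : Rel n m) j → count (M* j) ≤ 1 →
                   count (λ i → M* j i ∧ matched M j) ≤ count (M j)
count-∧-matched≤ M M* j atMostOne with matched M j in mj
... | true  = ≤-trans (≤-reflexive (count-cong (λ i → ∧-identityʳ (M* j i))))
                      (≤-trans atMostOne (anyF⇒1≤count (M j) mj))
... | false = ≤-trans (≤-reflexive (count-none (λ i → ∧-zeroʳ (M* j i)))) z≤n

chargeable⇒card≤2*card : ∀ {n m} {M M* : Rel n m} → (∀ j → count (M* j) ≤ 1) →
                          (∀ i → Chargeable M M* i) → card M* ≤ 2 * card M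
chargeable⇒card≤2*card {M = M} {M*} atMostOne charge = begin
  card M*                          ≡⟨ card≡sumF-deg M* ⟩
  sumF (deg M*)                    ≤⟨ sumF-mono charge ⟩
  sumF (λ i → deg C i + deg M i)   ≡⟨ sumF-+ (deg C) (deg M) ⟩
  sumF (deg C) + sumF (deg M)      ≡⟨ cong₂ _+_ (sym (card≡sumF-deg C)) (sym (card≡sumF-deg M)) ⟩
  card C + card M                  ≤⟨ +-monoˡ-≤ (card M) (sumF-mono C-row≤M-row) ⟩
  card M + card M                  ≡⟨ cong (card M +_) (sym (+-identityʳ (card M))) ⟩
  2 * card M                       ∎
  where
  open ≤-Reasoning
  C : Rel _ _
  C j i = M* j i ∧ matched M j
  C-row≤M-row : ∀ j → count (C j) ≤ count (M j)
  C-row≤M-row j = count-∧-matched≤ M M* j (atMostOne j)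

module _ {n m} {b : Fin n → Fin m → ℕ} {i : Fin m} {M M′ : Rel n m} (step : Step b i M M′) where
  open Step step

  Step-⊆ : M ⊆ᴿ M′
  Step-⊆ j i′ p rewrite M'-def j i′ | p = refl

  chosen⊆M′ : S ⊆ᵇ (λ j → M′ j i)
  chosen⊆M′ j p rewrite M'-def j i | p | ≟-diag i = ∨-zeroʳ (M j i)

  M′-elsewhere : ∀ {i′} → i′ ≢ i → ∀ j → M′ j i′ ≡ M j i′
  M′-elsewhere {i′} i′≢i j = begin
    M′ j i′                         ≡⟨ M'-def j i′ ⟩
    M j i′ ∨ (S j ∧ ⌊ i′ ≟ i ⌋)     ≡⟨ cong (λ c → M j i′ ∨ (S j ∧ c)) (≟-off-diag i′≢i) ⟩
    M j i′ ∨ (S j ∧ false)          ≡⟨ cong (M j i′ ∨_) (∧-zeroʳ (S j)) ⟩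
    M j i′ ∨ false                  ≡⟨ ∨-identityʳ (M j i′) ⟩
    M j i′                          ∎
    where open ≡-Reasoning

  M′-at-free : (∀ j → M j i ≡ false) → ∀ j → M′ j i ≡ S j
  M′-at-free free j rewrite M'-def j i | free j | ≟-diag i = ∧-identityʳ (S j)

  -- If a chosen job j had b(j,i) < k, every unmatched job with b(·,i) ≥ k
  -- would lie in S ∖ {j}, so fewer than k jobs would qualify for k.
  chosen-tolerance : ∀ j → S j ≡ true → k ≤ b j i
  chosen-tolerance j j∈S with k ≤? b j i
  ... | yes k≤b = k≤b
  ... | no  k≰b = contradiction k-ok (<⇒≱ qualifying<k)
    where
    qualifying : Fin n → Bool
    qualifying j′ = unmatched M j′ ∧ (k ≤ᵇ b j′ i)
    qualifying⊆S : qualifying ⊆ᵇ S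
    qualifying⊆S j′ p with S j′ in j′∉S
    ... | true  = refl
    ... | false = contradiction (≤-trans (≤ᵇ-sound k _ (∧-elimʳ p)) (S-top j j′ j∈S (∧-elimˡ p) j′∉S))
                                k≰b
    j-unqualified : qualifying j ≡ false
    j-unqualified rewrite S-unm j j∈S with k ≤ᵇ b j i in k≤ᵇb
    ... | true  = contradiction (≤ᵇ-sound k _ k≤ᵇb) k≰b
    ... | false = refl
    qualifying<k : numAbove b M i k < k
    qualifying<k = subst (numAbove b M i k <_) S-size
                     (count-strictMono qualifying⊆S j j∈S j-unqualified)

  chosen-row : ∀ j → S j ≡ true → M′ j ≗ (λ i′ → ⌊ i′ ≟ i ⌋)
  chosen-row j j∈S i′ rewrite M'-def j i′ | unmatched⇒free M j (S-unm j j∈S) i′ | j∈S = refl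

  unchosen-row : ∀ j → S j ≡ false → M′ j ≗ M j
  unchosen-row j j∉S i′ rewrite M'-def j i′ | j∉S = ∨-identityʳ (M j i′)

  Step-preserves-PD : IsPDMatching b M → (∀ j → M j i ≡ false) → IsPDMatching b M′
  Step-preserves-PD pd free = record { atMostOne = atMostOne′ ; tolerance = tolerance′ }
    where
    open IsPDMatching pd
    atMostOne′ : ∀ j → count (M′ j) ≤ 1
    atMostOne′ j with S j in j∈S
    ... | true  = ≤-reflexive (trans (count-cong (chosen-row j j∈S)) (count-≟ i))
    ... | false = ≤-trans (≤-reflexive (count-cong (unchosen-row j j∈S))) (atMostOne j)
    tolerance′ : ∀ j i′ → M′ j i′ ≡ true → deg M′ i′ ≤ b j i′
    tolerance′ j i′ p with i′ ≟ i
    ... | yes refl = subst (_≤ b j i) (sym (trans (count-cong (M′-at-free free)) S-size))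
                       (chosen-tolerance j (trans (sym (M′-at-free free j)) p))
    ... | no  i′≢i = subst (_≤ b j i′) (sym (count-cong (λ j′ → M′-elsewhere i′≢i j′)))
                       (tolerance j i′ (trans (sym (M′-elsewhere i′≢i j)) p))

  unmatched-partners≤k : ∀ {M*} → IsPDMatching b M* →
                         count (λ j → M* j i ∧ unmatched M j) ≤ k
  unmatched-partners≤k {M*} pd* = k-max a (count-mono qualify)
    where
    a : ℕ
    a = count (λ j → M* j i ∧ unmatched M j)
    qualify : (λ j → M* j i ∧ unmatched M j) ⊆ᵇ (λ j → unmatched M j ∧ (a ≤ᵇ b j i))
    qualify j p = ∧-intro (∧-elimʳ p) (≤ᵇ-complete (begin
      a          ≤⟨ count-mono {n} (λ _ → ∧-elimˡ) ⟩
      deg M* i   ≤⟨ IsPDMatching.tolerance pd* j i (∧-elimˡ p) ⟩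
      b j i      ∎))
      where open ≤-Reasoning

  Step-chargeable : ∀ {M*} → IsPDMatching b M* → Chargeable M′ M* i
  Step-chargeable {M*} pd* = begin
    deg M* i
      ≡⟨ count-partition (λ j → M* j i) (matched M) ⟩
    count (λ j → M* j i ∧ matched M j) + count (λ j → M* j i ∧ unmatched M j)
      ≤⟨ +-mono-≤ (count-∧-matched-mono M* i Step-⊆) (unmatched-partners≤k pd*) ⟩
    count (λ j → M* j i ∧ matched M′ j) + k
      ≤⟨ +-monoʳ-≤ _ (subst (_≤ deg M′ i) S-size (count-mono chosen⊆M′)) ⟩
    count (λ j → M* j i ∧ matched M′ j) + deg M′ i
      ∎
    where open ≤-Reasoning

module _ {n m} {b : Fin n → Fin m → ℕ} where

  Run-⊆ : ∀ {is M₀ M} → Run b is M₀ M → M₀ ⊆ᴿ M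
  Run-⊆ done          j i p = p
  Run-⊆ (step st run) j i p = Run-⊆ run j i (Step-⊆ st j i p)

  Run-chargeable : ∀ {is M₀ M M*} → Run b is M₀ M → IsPDMatching b M* →
                   ∀ {i} → i ∈ is → Chargeable M M* i
  Run-chargeable {M* = M*} (step st run) pd* (here refl) =
    Chargeable-mono M* _ (Run-⊆ run) (Step-chargeable st pd*)
  Run-chargeable (step st run) pd* (there i∈is) = Run-chargeable run pd* i∈is

  Run-preserves-PD : ∀ {is M₀ M} → Run b is M₀ M → Unique is → IsPDMatching b M₀ →
                     (∀ {i} → i ∈ is → ∀ j → M₀ j i ≡ false) → IsPDMatching b M
  Run-preserves-PD done          _              pd free = pd
  Run-preserves-PD (step {is = is} {M' = M₁} st run) (i∉is ∷ uniq) pd free =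
    Run-preserves-PD run uniq (Step-preserves-PD st pd (free (here refl))) free′
    where
    free′ : ∀ {i′} → i′ ∈ is → ∀ j → M₁ j i′ ≡ false
    free′ i′∈is j = trans (M′-elsewhere st (λ i′≡i → lookup i∉is i′∈is (sym i′≡i)) j)
                          (free (there i′∈is) j)

↭allFin⇒Unique : ∀ {m} {order : List (Fin m)} → order ↭ allFin m → Unique order
↭allFin⇒Unique {m} order↭ = Unique-resp-↭ (setoid (Fin m)) (↭⇒↭ₛ (↭-sym order↭)) (allFin⁺ m)

↭allFin⇒∈ : ∀ {m} {order : List (Fin m)} → order ↭ allFin m → ∀ i → i ∈ order
↭allFin⇒∈ order↭ i = ∈-resp-↭ (↭-sym order↭) (∈-allFin i)

theorem1 : ∀ (n m : ℕ) (b : Fin n → Fin m → ℕ) (order : List (Fin m)) (M : Rel n m) →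
    order ↭ allFin m → Run b order emptyRel M →
    IsPDMatching b M × (∀ (M* : Rel n m) → IsPDMatching b M* → card M* ≤ 2 * card M)
theorem1 n m b order M order↭ run = isPD , approx
  where
  isPD : IsPDMatching b M
  isPD = Run-preserves-PD run (↭allFin⇒Unique order↭) (emptyRel-isPDMatching b) (λ _ _ → refl)
  approx : ∀ (M* : Rel n m) → IsPDMatching b M* → card M* ≤ 2 * card M
  approx M* pd* = chargeable⇒card≤2*card (IsPDMatching.atMostOne pd*)
                    (λ i → Run-chargeable run pd* (↭allFin⇒∈ order↭ i))
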